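{- Let $q$ and $s$ be indeterminates and consider linear operators on the space of polynomials in $x$. Let $X$ be multiplication by $x$, $D_q$ the $q$-differentiation operator $D_qf(x)=\frac{f(qx)-f(x)}{(q-1)x}$, and for a polynomial $g$ let $g(X)$ be multiplication by $g(x)$. Define $$h_n(x,s)=\sum_{j=0}^{\lfloor n/2\rfloor} q^{j^2}s^j\frac{[n]!}{(1+q)(1+q^2)\cdots(1+q^j)\,[j]!\,[n-2j]!}x^{n-2j}.$$ Then for every $n\ge0$, $$(X+qsD_q)(X+q^3sD_q)\cdots(X+q^{2n-1}sD_q)=\sum_{k=0}^n\begin{bmatrix} n\\ k\end{bmatrix}q^{kn}\,h_{n-k}(X,s)\,(sD_q)^k.$$
   Context: Notation: $[n]=1+q+\cdots+q^{n-1}$, $[n]!=[1][2]\cdots[n]$ with $[0]!=1$, and $\begin{bmatrix} n\\ k\end{bmatrix}=\frac{[n]!}{[k]![n-k]!}$ is the $q$-binomial coefficient. For $n=0$ the left-hand product is the identity operator. -}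

module Defs where

open import Level using (_⊔_)
open import Algebra.Bundles using (CommutativeRing)
open import Data.Nat using (ℕ; zero; suc; _∸_; _≤_; ⌊_/2⌋) renaming (_+_ to _+ℕ_; _*_ to _*ℕ_)
open import Data.List using (List; []; _∷_; map; foldr; upTo)
open import Function using (id; _∘_)

module QOps {c ℓ} (R : CommutativeRing c ℓ) (q s : CommutativeRing.Carrier R) where
  open CommutativeRing R public

  pow : Carrier → ℕ → Carrier
  pow a zero = 1#
  pow a (suc n) = a * pow a n

  qint : ℕ → Carrier
  qint zero = 0#
  qint (suc n) = 1# + q * qint n

  qfact : ℕ → Carrier
  qfact zero = 1#
  qfact (suc n) = qint (suc n) * qfact n

  onePlusProd : ℕ → Carrier
  onePlusProd zero = 1#
  onePlusProd (suc j) = (1# + pow q (suc j)) * onePlusProd j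

  NonZeroDivisor : Carrier → Set (c ⊔ ℓ)
  NonZeroDivisor r = ∀ a → r * a ≈ 0# → a ≈ 0#

  -- Polynomials in x over R: coefficient lists, constant term first.
  Poly : Set c
  Poly = List Carrier

  coeff : Poly → ℕ → Carrier
  coeff [] m = 0#
  coeff (a ∷ f) zero = a
  coeff (a ∷ f) (suc m) = coeff f m

  -- equality of polynomials (coefficientwise; trailing zeros irrelevant)
  _≈P_ : Poly → Poly → Set ℓ
  f ≈P g = ∀ m → coeff f m ≈ coeff g m

  addP : Poly → Poly → Poly
  addP [] g = g
  addP (a ∷ f) [] = a ∷ f
  addP (a ∷ f) (b ∷ g) = (a + b) ∷ addP f g

  scaleP : Carrier → Poly → Poly
  scaleP a = map (a *_)

  negP : Poly → Poly
  negP = map (λ a → - a)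

  mulP : Poly → Poly → Poly
  mulP [] g = []
  mulP (a ∷ f) g = addP (scaleP a g) (0# ∷ mulP f g)

  dilate : Poly → Poly
  dilate [] = []
  dilate (a ∷ f) = a ∷ scaleP q (dilate f)

  monomial : Carrier → ℕ → Poly
  monomial a zero = a ∷ []
  monomial a (suc m) = 0# ∷ monomial a m

  sumP : List Poly → Poly
  sumP = foldr addP []

  Op : Set c
  Op = Poly → Poly

  _≈O_ : Op → Op → Set (c ⊔ ℓ)
  A ≈O B = ∀ f → A f ≈P B f

  Xop : Op
  Xop f = 0# ∷ f

  mulBy : Poly → Op
  mulBy g f = mulP g f

  IsQDerivative : Op → Set (c ⊔ ℓ)
  IsQDerivative D = ∀ f → scaleP (q - 1#) (Xop (D f)) ≈P addP (dilate f) (negP f)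

  iterOp : ℕ → Op → Op
  iterOp zero A = id
  iterOp (suc k) A = A ∘ iterOp k A

  -- A_1 A_2 ... A_n (A_1 leftmost, i.e. applied last)
  compOps : List Op → Op
  compOps = foldr (λ A B → A ∘ B) id

  IsQBinomial : (ℕ → ℕ → Carrier) → Set ℓ
  IsQBinomial B = ∀ n k → k ≤ n → B n k * (qfact k * qfact (n ∸ k)) ≈ qfact n

  IsHCoeff : (ℕ → ℕ → Carrier) → Set ℓ
  IsHCoeff C = ∀ n j → 2 *ℕ j ≤ n →
    C n j * (onePlusProd j * qfact j * qfact (n ∸ 2 *ℕ j)) ≈ qfact n

  hPoly : (ℕ → ℕ → Carrier) → ℕ → Poly
  hPoly C n = sumP (map (λ j → monomial (pow q (j *ℕ j) * pow s j * C n j) (n ∸ 2 *ℕ j))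
                        (upTo (suc ⌊ n /2⌋)))

  lhsOp : Op → ℕ → Op
  lhsOp D n = compOps (map (λ i → λ f → addP (Xop f) (scaleP (pow q (2 *ℕ i +ℕ 1) * s) (D f)))
                           (upTo n))

  rhsOp : Op → (ℕ → ℕ → Carrier) → (ℕ → ℕ → Carrier) → ℕ → Op
  rhsOp D B C n f =
    sumP (map (λ k → scaleP (B n k * pow q (k *ℕ n))
                       (mulBy (hPoly C (n ∸ k)) (iterOp k (λ g → scaleP s (D g)) f)))
              (upTo (suc n)))

module Submission where

-- Since every operator involved is determined by its action on coefficients, we
-- work with coefficient sequences a : ℕ → R.  There X shifts, and the hypothesis
-- on D together with the non-zero-divisor q - 1 forces (Da)ₘ = [m+1] a_{m+1}.
-- Both sides thereby become explicit operators on sequences, and the theorem is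
-- proved by induction on n, peeling off the innermost factor X + q^{2n+1} sD using
--   * the commutation rule (sD)ᵏ X = qᵏ X (sD)ᵏ + [k] s (sD)^{k-1};
--   * the three-term recurrence h_{t+1} = X h_t + qᵗ [t] s h_{t-1};
--   * the q-Pascal recurrence for G n k = [n k] q^{kn} and the absorption
--     identity qⁿ [n-k] G n k = [k+1] G n (k+1).
-- The closed forms h_n and [n k] of the statement are characterised only through
-- their defining products (IsHCoeff, IsQBinomial); we identify them with the
-- recursive versions by cancelling the non-zero-divisors [m]! and (1+q)⋯(1+q^j).

open import Defs
open import Algebra.Bundles using (CommutativeRing)
open import Data.Nat using (ℕ; suc; zero; _∸_; _≤_; _<_; z≤n; s≤s; ⌊_/2⌋)
  renaming (_+_ to _+ℕ_; _*_ to _*ℕ_)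
import Data.Nat.Properties as ℕP
open import Data.Nat.Tactic.RingSolver using (solve-∀)
open import Data.List using ([]; _∷_; map; applyUpTo)
open import Data.Product using (Σ; _,_)
open import Data.Sum using (inj₁; inj₂)
open import Data.Empty using (⊥-elim)
open import Relation.Nullary using (¬_)
open import Relation.Binary.Definitions using (tri<; tri≈; tri>)
open import Function using (id; _∘_)
open import Relation.Binary.PropositionalEquality as ≡ using (_≡_)
import Relation.Binary.Reasoning.Setoid as SetoidReasoning

-- `double j` is 2j, defined by recursion so that it unfolds under pattern matching.
double : ℕ → ℕ
double zero = zero
double (suc j) = suc (suc (double j))

double≡+ : ∀ j → double j ≡ j +ℕ j
double≡+ zero = ≡.refl
double≡+ (suc j) = ≡.cong suc (≡.trans (≡.cong suc (double≡+ j)) (≡.sym (ℕP.+-suc j j)))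

double≡2* : ∀ j → double j ≡ 2 *ℕ j
double≡2* j = ≡.trans (double≡+ j) (≡.cong (j +ℕ_) (≡.sym (ℕP.+-identityʳ j)))

double-injective : ∀ a b → double a ≡ double b → a ≡ b
double-injective zero zero e = ≡.refl
double-injective (suc a) (suc b) e =
  ≡.cong suc (double-injective a b (ℕP.suc-injective (ℕP.suc-injective e)))

double≢odd : ∀ a b → ¬ (suc (double a) ≡ double b)
double≢odd zero (suc b) ()
double≢odd (suc a) (suc b) e = double≢odd a b (ℕP.suc-injective (ℕP.suc-injective e))

double≤ : ∀ t j → j ≤ ⌊ t /2⌋ → double j ≤ t
double≤ t zero _ = z≤n
double≤ (suc (suc t)) (suc j) (s≤s le) = s≤s (s≤s (double≤ t j le))

≤half : ∀ j m → j ≤ ⌊ double j +ℕ m /2⌋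
≤half zero m = z≤n
≤half (suc j) m = s≤s (≤half j m)

∸double : ∀ t j m → 2 *ℕ j ≤ t → t ∸ 2 *ℕ j ≡ m → t ≡ double j +ℕ m
∸double t j m le e = ≡.trans (≡.sym (ℕP.m∸n+n≡m le)) (≡.trans (≡.cong (_+ℕ 2 *ℕ j) e)
  (≡.trans (ℕP.+-comm m (2 *ℕ j)) (≡.cong (_+ℕ m) (≡.sym (double≡2* j)))))

double+∸2* : ∀ j m → (double j +ℕ m) ∸ 2 *ℕ j ≡ m
double+∸2* j m = ≡.trans (≡.cong (double j +ℕ m ∸_) (≡.sym (double≡2* j))) (ℕP.m+n∸m≡n (double j) m)

-- Position of the exponent m relative to the degree t: the coefficient of x^m in
-- h_t is zero above the degree and at odd distance, and explicit at even distance.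
data Position (t m : ℕ) : Set where
  above : t < m → Position t m
  even  : ∀ j → t ≡ double j +ℕ m → Position t m
  odd   : ∀ j → t ≡ suc (double j +ℕ m) → Position t m

position : ∀ t m → Position t m
position zero zero = even 0 ≡.refl
position (suc t) zero with position t zero
... | even j e = odd j (≡.cong suc e)
... | odd j e = even (suc j) (≡.cong suc e)
position zero (suc m) = above (s≤s z≤n)
position (suc t) (suc m) with position t m
... | above lt = above (s≤s lt)
... | even j e = even j (≡.trans (≡.cong suc e) (≡.sym (ℕP.+-suc (double j) m)))
... | odd j e = odd j (≡.trans (≡.cong suc e) (≡.cong suc (≡.sym (ℕP.+-suc (double j) m))))

split< : ∀ {k n} → k < n → Σ ℕ (λ t → n ≡ t +ℕ suc k)
split< {k} {n} lt = n ∸ suc k , ≡.sym (ℕP.m∸n+n≡m lt)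

module Exponents where
  n∸k : ∀ t k → (t +ℕ suc k) ∸ k ≡ suc t
  n∸k t k = ≡.trans (≡.cong (_∸ k) (ℕP.+-suc t k)) (ℕP.m+n∸n≡m (suc t) k)

  n∸[k+1] : ∀ t k → (t +ℕ suc k) ∸ suc k ≡ t
  n∸[k+1] t k = ℕP.m+n∸n≡m t (suc k)

  n∸[k+2] : ∀ t k → (t +ℕ suc k) ∸ suc (suc k) ≡ t ∸ 1
  n∸[k+2] t k = ≡.trans (≡.cong (λ x → (t +ℕ suc k) ∸ suc x) (ℕP.+-comm 1 k))
    (≡.trans (≡.sym (ℕP.∸-+-assoc (t +ℕ suc k) (suc k) 1)) (≡.cong (_∸ 1) (n∸[k+1] t k)))

  -- exponents of q in the q-Pascal recurrence
  pascal-top : ∀ n → (2 *ℕ n +ℕ 1) +ℕ n *ℕ n ≡ suc n *ℕ suc n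
  pascal-top = solve-∀

  pascal-left : ∀ k n → suc k +ℕ suc k *ℕ n ≡ suc k *ℕ suc n
  pascal-left = solve-∀

  pascal-right : ∀ t k → (2 *ℕ (t +ℕ suc k) +ℕ 1) +ℕ k *ℕ (t +ℕ suc k)
                         ≡ suc k *ℕ suc (t +ℕ suc k) +ℕ suc t
  pascal-right = solve-∀

  -- exponents of q in the even coefficients of h_t
  square-step : ∀ j → suc j *ℕ suc j ≡ suc (double j +ℕ 0) +ℕ j *ℕ j
  square-step j rewrite double≡+ j = lemma j
    where
    lemma : ∀ j → suc j *ℕ suc j ≡ suc (j +ℕ j +ℕ 0) +ℕ j *ℕ j
    lemma = solve-∀

  square-shift : ∀ j m → suc (double j +ℕ suc m) +ℕ j *ℕ j ≡ suc j *ℕ suc j +ℕ suc m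
  square-shift j m rewrite double≡+ j = lemma j m
    where
    lemma : ∀ j m → suc (j +ℕ j +ℕ suc m) +ℕ j *ℕ j ≡ suc j *ℕ suc j +ℕ suc m
    lemma = solve-∀

  degree-shift : ∀ j m → suc m +ℕ double (suc j) ≡ suc (suc (double j +ℕ suc m))
  degree-shift j m rewrite double≡+ j = lemma j m
    where
    lemma : ∀ j m → suc m +ℕ suc (suc (j +ℕ j)) ≡ suc (suc (j +ℕ j +ℕ suc m))
    lemma = solve-∀

module Development {c ℓ} (R : CommutativeRing c ℓ) (q s : CommutativeRing.Carrier R) where
  open QOps R q s renaming (zero to *-zero)
  open SetoidReasoning setoid
  open import Algebra.Properties.Ring ring using (x[y-z]≈xy-xz; [y-z]x≈yx-zx; x∙y⁻¹≈ε⇒x≈y; -0#≈0#)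
  open import Algebra.Solver.Ring.NaturalCoefficients.Default commutativeSemiring
    using (solve; _:=_; _:+_; _:*_)

  cancelˡ : ∀ r → NonZeroDivisor r → ∀ x y → r * x ≈ r * y → x ≈ y
  cancelˡ r nz x y e = x∙y⁻¹≈ε⇒x≈y x y (nz (x - y) (begin
    r * (x - y)   ≈⟨ x[y-z]≈xy-xz r x y ⟩
    r * x - r * y ≈⟨ +-congʳ e ⟩
    r * y - r * y ≈⟨ -‿inverseʳ (r * y) ⟩
    0# ∎))

  cancelʳ : ∀ r → NonZeroDivisor r → ∀ x y → x * r ≈ y * r → x ≈ y
  cancelʳ r nz x y e = cancelˡ r nz x y (trans (*-comm r x) (trans e (*-comm y r)))

  nzd-1 : NonZeroDivisor 1#
  nzd-1 x e = trans (sym (*-identityˡ x)) e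

  nzd-* : ∀ a b → NonZeroDivisor a → NonZeroDivisor b → NonZeroDivisor (a * b)
  nzd-* a b na nb x e = nb x (na (b * x) (trans (sym (*-assoc a b x)) e))

  nzd-product : (f : ℕ → Carrier) → (∀ m → NonZeroDivisor (f m)) →
    (P : ℕ → Carrier) → P 0 ≈ 1# → (∀ k → P (suc k) ≈ f k * P k) → ∀ k → NonZeroDivisor (P k)
  nzd-product f nz P P0 Ps zero x e = nzd-1 x (trans (*-congʳ (sym P0)) e)
  nzd-product f nz P P0 Ps (suc k) x e =
    nzd-* (f k) (P k) (nz k) (nzd-product f nz P P0 Ps k) x (trans (*-congʳ (sym (Ps k))) e)

  nz-qfact : (∀ m → NonZeroDivisor (qint (suc m))) → ∀ k → NonZeroDivisor (qfact k)
  nz-qfact nz = nzd-product _ nz qfact refl (λ _ → refl)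

  absorbˡ : ∀ {g} x → g ≈ 0# → g * x ≈ 0#
  absorbˡ x e = trans (*-congʳ e) (zeroˡ x)

  Σ< : ℕ → (ℕ → Carrier) → Carrier
  Σ< zero h = 0#
  Σ< (suc N) h = h 0 + Σ< N (h ∘ suc)

  Σ-cong : ∀ N {h h'} → (∀ k → k < N → h k ≈ h' k) → Σ< N h ≈ Σ< N h'
  Σ-cong zero e = refl
  Σ-cong (suc N) e = +-cong (e 0 (s≤s z≤n)) (Σ-cong N (λ k k<N → e (suc k) (s≤s k<N)))

  Σ-+ : ∀ N h h' → Σ< N (λ k → h k + h' k) ≈ Σ< N h + Σ< N h'
  Σ-+ zero h h' = sym (+-identityˡ 0#)
  Σ-+ (suc N) h h' = begin
    (h 0 + h' 0) + Σ< N (λ k → h (suc k) + h' (suc k))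
      ≈⟨ +-congˡ (Σ-+ N (h ∘ suc) (h' ∘ suc)) ⟩
    (h 0 + h' 0) + (Σ< N (h ∘ suc) + Σ< N (h' ∘ suc))
      ≈⟨ solve 4 (λ a b c d → ((a :+ b) :+ (c :+ d)) := ((a :+ c) :+ (b :+ d))) refl _ _ _ _ ⟩
    (h 0 + Σ< N (h ∘ suc)) + (h' 0 + Σ< N (h' ∘ suc)) ∎

  Σ-0 : ∀ N h → (∀ k → k < N → h k ≈ 0#) → Σ< N h ≈ 0#
  Σ-0 zero h e = refl
  Σ-0 (suc N) h e =
    trans (+-cong (e 0 (s≤s z≤n)) (Σ-0 N _ (λ k k<N → e (suc k) (s≤s k<N)))) (+-identityˡ 0#)

  Σ-single : ∀ N h j → j < N → (∀ k → k < N → ¬ (k ≡ j) → h k ≈ 0#) → Σ< N h ≈ h j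
  Σ-single (suc N) h zero lt e =
    trans (+-congˡ (Σ-0 N _ (λ k k<N → e (suc k) (s≤s k<N) (λ ())))) (+-identityʳ _)
  Σ-single (suc N) h (suc j) (s≤s lt) e =
    trans (+-cong (e 0 (s≤s z≤n) (λ ()))
                  (Σ-single N (h ∘ suc) j lt (λ k k<N ne → e (suc k) (s≤s k<N) (ne ∘ ℕP.suc-injective))))
          (+-identityˡ _)

  Σ-drop-last : ∀ N h → h N ≈ 0# → Σ< (suc N) h ≈ Σ< N h
  Σ-drop-last zero h e = trans (+-identityʳ _) e
  Σ-drop-last (suc N) h e = +-congˡ (Σ-drop-last N (h ∘ suc) e)

  shiftUp : (ℕ → Carrier) → ℕ → Carrier
  shiftUp C zero = 0#
  shiftUp C (suc k) = C k

  Σ-regroup : ∀ N (A B C : ℕ → Carrier) → A N ≈ 0# → B 0 ≈ 0# → B N ≈ 0# → B (suc N) ≈ 0# →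
    Σ< N (λ k → (A k + B k) + C k) ≈ Σ< (suc N) (λ k → (A k + B (suc k)) + shiftUp C k)
  Σ-regroup N A B C A-top B-0 B-top B-top+1 = begin
    Σ< N (λ k → (A k + B k) + C k)           ≈⟨ trans (Σ-+ N (λ k → A k + B k) C) (+-congʳ (Σ-+ N A B)) ⟩
    (Σ< N A + Σ< N B) + Σ< N C               ≈⟨ +-cong (+-cong (sym (Σ-drop-last N A A-top)) B-shift) (sym (+-identityˡ _)) ⟩
    (Σ< (suc N) A + Σ< (suc N) (B ∘ suc)) + Σ< (suc N) (shiftUp C)
      ≈⟨ sym (trans (Σ-+ (suc N) (λ k → A k + B (suc k)) (shiftUp C)) (+-congʳ (Σ-+ (suc N) A (B ∘ suc)))) ⟩
    Σ< (suc N) (λ k → (A k + B (suc k)) + shiftUp C k) ∎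
    where
    B-shift : Σ< N B ≈ Σ< (suc N) (B ∘ suc)
    B-shift = begin
      Σ< N B                 ≈⟨ sym (Σ-drop-last N B B-top) ⟩
      B 0 + Σ< N (B ∘ suc)   ≈⟨ trans (+-congʳ B-0) (+-identityˡ _) ⟩
      Σ< N (B ∘ suc)         ≈⟨ sym (Σ-drop-last N (B ∘ suc) B-top+1) ⟩
      Σ< (suc N) (B ∘ suc) ∎

  Seq : Set c
  Seq = ℕ → Carrier

  _≈S_ : Seq → Seq → Set ℓ
  a ≈S b = ∀ m → a m ≈ b m

  HasCoeffs : Poly → Seq → Set ℓ
  HasCoeffs f a = ∀ m → coeff f m ≈ a m

  0S : Seq
  0S _ = 0#

  _+S_ : Seq → Seq → Seq
  (a +S b) m = a m + b m

  _·S_ : Carrier → Seq → Seq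
  (r ·S a) m = r * a m

  infixl 6 _+S_
  infixr 7 _·S_

  Xs : Seq → Seq
  Xs a zero = 0#
  Xs a (suc m) = a m

  Xs-cong : ∀ {a b} → a ≈S b → Xs a ≈S Xs b
  Xs-cong e zero = refl
  Xs-cong e (suc m) = e m

  Xs-+ : ∀ a b → Xs (a +S b) ≈S (Xs a +S Xs b)
  Xs-+ a b zero = sym (+-identityˡ 0#)
  Xs-+ a b (suc m) = refl

  Xs-· : ∀ r a → Xs (r ·S a) ≈S (r ·S Xs a)
  Xs-· r a zero = sym (zeroʳ r)
  Xs-· r a (suc m) = refl

  Xs-0 : ∀ a → a ≈S 0S → Xs a ≈S 0S
  Xs-0 a e zero = refl
  Xs-0 a e (suc m) = e m

  coeff-Xop : ∀ {f a} → HasCoeffs f a → HasCoeffs (Xop f) (Xs a)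
  coeff-Xop r zero = refl
  coeff-Xop r (suc m) = r m

  coeff-addP : ∀ f g m → coeff (addP f g) m ≈ coeff f m + coeff g m
  coeff-addP [] g m = sym (+-identityˡ _)
  coeff-addP (a ∷ f) [] zero = sym (+-identityʳ a)
  coeff-addP (a ∷ f) [] (suc m) = sym (+-identityʳ _)
  coeff-addP (a ∷ f) (b ∷ g) zero = refl
  coeff-addP (a ∷ f) (b ∷ g) (suc m) = coeff-addP f g m

  coeff-scaleP : ∀ a f m → coeff (scaleP a f) m ≈ a * coeff f m
  coeff-scaleP a [] m = sym (zeroʳ a)
  coeff-scaleP a (b ∷ f) zero = refl
  coeff-scaleP a (b ∷ f) (suc m) = coeff-scaleP a f m

  coeff-negP : ∀ f m → coeff (negP f) m ≈ - coeff f m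
  coeff-negP [] m = sym -0#≈0#
  coeff-negP (b ∷ f) zero = refl
  coeff-negP (b ∷ f) (suc m) = coeff-negP f m

  coeff-dilate : ∀ f m → coeff (dilate f) m ≈ pow q m * coeff f m
  coeff-dilate [] m = sym (zeroʳ _)
  coeff-dilate (b ∷ f) zero = sym (*-identityˡ b)
  coeff-dilate (b ∷ f) (suc m) = begin
    coeff (scaleP q (dilate f)) m  ≈⟨ coeff-scaleP q (dilate f) m ⟩
    q * coeff (dilate f) m         ≈⟨ *-congˡ (coeff-dilate f m) ⟩
    q * (pow q m * coeff f m)      ≈⟨ sym (*-assoc q _ _) ⟩
    pow q (suc m) * coeff f m ∎

  coeff-monomial-≡ : ∀ a d → coeff (monomial a d) d ≈ a
  coeff-monomial-≡ a zero = refl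
  coeff-monomial-≡ a (suc d) = coeff-monomial-≡ a d

  coeff-monomial-≢ : ∀ a d m → ¬ (d ≡ m) → coeff (monomial a d) m ≈ 0#
  coeff-monomial-≢ a zero zero ne = ⊥-elim (ne ≡.refl)
  coeff-monomial-≢ a zero (suc m) ne = refl
  coeff-monomial-≢ a (suc d) zero ne = refl
  coeff-monomial-≢ a (suc d) (suc m) ne = coeff-monomial-≢ a d m (ne ∘ ≡.cong suc)

  coeff-sumP : ∀ {A : Set} (φ : A → Poly) (g : ℕ → A) N m →
    coeff (sumP (map φ (applyUpTo g N))) m ≈ Σ< N (λ k → coeff (φ (g k)) m)
  coeff-sumP φ g zero m = refl
  coeff-sumP φ g (suc N) m =
    trans (coeff-addP (φ (g 0)) _ m) (+-congˡ (coeff-sumP φ (g ∘ suc) N m))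

  polyMul : Poly → Seq → Seq
  polyMul [] a m = 0#
  polyMul (b ∷ g) a m = b * a m + Xs (polyMul g a) m

  coeff-mulP : ∀ g f {a} → HasCoeffs f a → HasCoeffs (mulP g f) (polyMul g a)
  coeff-mulP [] f r m = refl
  coeff-mulP (b ∷ g) f r m = trans (coeff-addP (scaleP b f) (0# ∷ mulP g f) m)
    (+-cong (trans (coeff-scaleP b f m) (*-congˡ (r m))) (coeff-Xop (coeff-mulP g f r) m))

  polyMul-cong : ∀ g {a b} → a ≈S b → polyMul g a ≈S polyMul g b
  polyMul-cong [] e m = refl
  polyMul-cong (x ∷ g) e m = +-cong (*-congˡ (e m)) (Xs-cong (polyMul-cong g e) m)

  polyMul-+ : ∀ g a b → polyMul g (a +S b) ≈S (polyMul g a +S polyMul g b)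
  polyMul-+ [] a b m = sym (+-identityˡ 0#)
  polyMul-+ (x ∷ g) a b m = begin
    x * (a m + b m) + Xs (polyMul g (a +S b)) m
      ≈⟨ +-cong (distribˡ x _ _) (trans (Xs-cong (polyMul-+ g a b) m) (Xs-+ _ _ m)) ⟩
    (x * a m + x * b m) + (Xs (polyMul g a) m + Xs (polyMul g b) m)
      ≈⟨ solve 4 (λ a b c d → ((a :+ b) :+ (c :+ d)) := ((a :+ c) :+ (b :+ d))) refl _ _ _ _ ⟩
    (x * a m + Xs (polyMul g a) m) + (x * b m + Xs (polyMul g b) m) ∎

  polyMul-· : ∀ g r a → polyMul g (r ·S a) ≈S (r ·S polyMul g a)
  polyMul-· [] r a m = sym (zeroʳ r)
  polyMul-· (x ∷ g) r a m = begin
    x * (r * a m) + Xs (polyMul g (r ·S a)) m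
      ≈⟨ +-cong (solve 3 (λ x r a → (x :* (r :* a)) := (r :* (x :* a))) refl x r (a m))
                (trans (Xs-cong (polyMul-· g r a) m) (Xs-· r _ m)) ⟩
    r * (x * a m) + r * Xs (polyMul g a) m ≈⟨ sym (distribˡ r _ _) ⟩
    r * (x * a m + Xs (polyMul g a) m) ∎

  polyMul-0 : ∀ g a → a ≈S 0S → polyMul g a ≈S 0S
  polyMul-0 [] a e m = refl
  polyMul-0 (x ∷ g) a e m =
    trans (+-cong (trans (*-congˡ (e m)) (zeroʳ x)) (Xs-0 _ (polyMul-0 g a e) m)) (+-identityˡ 0#)

  polyMul-Xs : ∀ g a → polyMul g (Xs a) ≈S Xs (polyMul g a)
  polyMul-Xs [] a zero = refl
  polyMul-Xs [] a (suc m) = refl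
  polyMul-Xs (x ∷ g) a zero = trans (+-identityʳ _) (zeroʳ x)
  polyMul-Xs (x ∷ g) a (suc m) = +-congˡ (polyMul-Xs g a m)

  polyMul-zero : ∀ g a → g ≈P [] → polyMul g a ≈S 0S
  polyMul-zero [] a e m = refl
  polyMul-zero (x ∷ g) a e m = trans (+-cong (absorbˡ _ (e 0))
    (Xs-0 _ (polyMul-zero g a (e ∘ suc)) m)) (+-identityˡ 0#)

  polyMul-≈P : ∀ g g' a → g ≈P g' → polyMul g a ≈S polyMul g' a
  polyMul-≈P [] [] a e m = refl
  polyMul-≈P [] (x ∷ g') a e m = sym (polyMul-zero (x ∷ g') a (λ k → sym (e k)) m)
  polyMul-≈P (x ∷ g) [] a e m = polyMul-zero (x ∷ g) a e m
  polyMul-≈P (x ∷ g) (y ∷ g') a e m =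
    +-cong (*-congʳ (e 0)) (Xs-cong (polyMul-≈P g g' a (e ∘ suc)) m)

  polyMul-addP : ∀ g h a → polyMul (addP g h) a ≈S (polyMul g a +S polyMul h a)
  polyMul-addP [] h a m = sym (+-identityˡ _)
  polyMul-addP (x ∷ g) [] a m = sym (+-identityʳ _)
  polyMul-addP (x ∷ g) (y ∷ h) a m = begin
    (x + y) * a m + Xs (polyMul (addP g h) a) m
      ≈⟨ +-cong (distribʳ _ x y) (trans (Xs-cong (polyMul-addP g h a) m) (Xs-+ _ _ m)) ⟩
    (x * a m + y * a m) + (Xs (polyMul g a) m + Xs (polyMul h a) m)
      ≈⟨ solve 4 (λ a b c d → ((a :+ b) :+ (c :+ d)) := ((a :+ c) :+ (b :+ d))) refl _ _ _ _ ⟩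
    (x * a m + Xs (polyMul g a) m) + (y * a m + Xs (polyMul h a) m) ∎

  polyMul-scaleP : ∀ r g a → polyMul (scaleP r g) a ≈S (r ·S polyMul g a)
  polyMul-scaleP r [] a m = sym (zeroʳ r)
  polyMul-scaleP r (x ∷ g) a m = begin
    r * x * a m + Xs (polyMul (scaleP r g) a) m
      ≈⟨ +-cong (*-assoc r x _) (trans (Xs-cong (polyMul-scaleP r g a) m) (Xs-· r _ m)) ⟩
    r * (x * a m) + r * Xs (polyMul g a) m ≈⟨ sym (distribˡ r _ _) ⟩
    r * (x * a m + Xs (polyMul g a) m) ∎

  polyMul-Xop : ∀ g a → polyMul (Xop g) a ≈S Xs (polyMul g a)
  polyMul-Xop g a m = trans (+-congʳ (zeroˡ _)) (+-identityˡ _)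

  pow-+ : ∀ x a b → pow x (a +ℕ b) ≈ pow x a * pow x b
  pow-+ x zero b = sym (*-identityˡ _)
  pow-+ x (suc a) b = trans (*-congˡ (pow-+ x a b)) (sym (*-assoc x _ _))

  qint-+ : ∀ a b → qint (a +ℕ b) ≈ qint a + pow q a * qint b
  qint-+ zero b = sym (trans (+-identityˡ _) (*-identityˡ _))
  qint-+ (suc a) b = begin
    1# + q * qint (a +ℕ b)                   ≈⟨ +-congˡ (*-congˡ (qint-+ a b)) ⟩
    1# + q * (qint a + pow q a * qint b)
      ≈⟨ solve 5 (λ o q qa pa qb → (o :+ q :* (qa :+ pa :* qb)) := ((o :+ q :* qa) :+ (q :* pa) :* qb))
                 refl 1# q (qint a) (pow q a) (qint b) ⟩
    (1# + q * qint a) + (q * pow q a) * qint b ∎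

  qint-1 : qint 1 ≈ 1#
  qint-1 = trans (+-congˡ (zeroʳ q)) (+-identityʳ 1#)

  qint-suc : ∀ k → qint (suc k) ≈ pow q k + qint k
  qint-suc k = begin
    qint (suc k)              ≈⟨ reflexive (≡.cong qint (ℕP.+-comm 1 k)) ⟩
    qint (k +ℕ 1)             ≈⟨ qint-+ k 1 ⟩
    qint k + pow q k * qint 1 ≈⟨ +-congˡ (trans (*-congˡ qint-1) (*-identityʳ _)) ⟩
    qint k + pow q k          ≈⟨ +-comm _ _ ⟩
    pow q k + qint k ∎

  onePlus-qint : ∀ j → (1# + pow q (suc j)) * qint (suc j) ≈ qint (double (suc j))
  onePlus-qint j = begin
    (1# + pow q (suc j)) * qint (suc j)              ≈⟨ distribʳ _ _ _ ⟩
    1# * qint (suc j) + pow q (suc j) * qint (suc j) ≈⟨ +-congʳ (*-identityˡ _) ⟩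
    qint (suc j) + pow q (suc j) * qint (suc j)      ≈⟨ sym (qint-+ (suc j) (suc j)) ⟩
    qint (suc j +ℕ suc j)                            ≈⟨ reflexive (≡.cong qint (≡.sym (double≡+ (suc j)))) ⟩
    qint (double (suc j)) ∎

  qint-telescope : ∀ k → (q - 1#) * qint k ≈ pow q k - 1#
  qint-telescope zero = trans (zeroʳ _) (sym (-‿inverseʳ 1#))
  qint-telescope (suc k) = begin
    (q - 1#) * (1# + q * qint k)             ≈⟨ distribˡ _ _ _ ⟩
    (q - 1#) * 1# + (q - 1#) * (q * qint k)
      ≈⟨ +-cong (*-identityʳ _) (solve 3 (λ a b c → (a :* (b :* c)) := (b :* (a :* c))) refl _ _ _) ⟩
    (q - 1#) + q * ((q - 1#) * qint k)       ≈⟨ +-congˡ (*-congˡ (qint-telescope k)) ⟩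
    (q - 1#) + q * (pow q k - 1#)            ≈⟨ +-congˡ (x[y-z]≈xy-xz q (pow q k) 1#) ⟩
    (q - 1#) + (q * pow q k - q * 1#)        ≈⟨ +-congˡ (+-congˡ (-‿cong (*-identityʳ q))) ⟩
    (q + - 1#) + (q * pow q k + - q)
      ≈⟨ solve 4 (λ a b c d → ((a :+ b) :+ (c :+ d)) := (c :+ (b :+ (a :+ d)))) refl q (- 1#) (q * pow q k) (- q) ⟩
    q * pow q k + (- 1# + (q + - q))         ≈⟨ +-congˡ (+-congˡ (-‿inverseʳ q)) ⟩
    q * pow q k + (- 1# + 0#)                ≈⟨ +-congˡ (+-identityʳ _) ⟩
    pow q (suc k) - 1# ∎

  Ds : Seq → Seq
  Ds a m = qint (suc m) * a (suc m)

  Ds-cong : ∀ {a b} → a ≈S b → Ds a ≈S Ds b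
  Ds-cong e m = *-congˡ (e (suc m))

  -- Any operator D with (q-1) x Df = f(qx) - f(x) acts as Ds, since q - 1 cancels.
  module QDerivative (nzq : NonZeroDivisor (q - 1#)) (D : Op) (isD : IsQDerivative D) where
    coeff-D : ∀ {f a} → HasCoeffs f a → HasCoeffs (D f) (Ds a)
    coeff-D {f} {a} r m = trans (cancelˡ (q - 1#) nzq _ _ (trans viaD (sym viaQint))) (*-congˡ (r (suc m)))
      where
      b = coeff f (suc m)
      viaD : (q - 1#) * coeff (D f) m ≈ pow q (suc m) * b - b
      viaD = begin
        (q - 1#) * coeff (D f) m                          ≈⟨ sym (coeff-scaleP (q - 1#) (Xop (D f)) (suc m)) ⟩
        coeff (scaleP (q - 1#) (Xop (D f))) (suc m)        ≈⟨ isD f (suc m) ⟩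
        coeff (addP (dilate f) (negP f)) (suc m)           ≈⟨ coeff-addP (dilate f) (negP f) (suc m) ⟩
        coeff (dilate f) (suc m) + coeff (negP f) (suc m)  ≈⟨ +-cong (coeff-dilate f (suc m)) (coeff-negP f (suc m)) ⟩
        pow q (suc m) * b - b ∎
      viaQint : (q - 1#) * (qint (suc m) * b) ≈ pow q (suc m) * b - b
      viaQint = begin
        (q - 1#) * (qint (suc m) * b)  ≈⟨ sym (*-assoc _ _ _) ⟩
        ((q - 1#) * qint (suc m)) * b  ≈⟨ *-congʳ (qint-telescope (suc m)) ⟩
        (pow q (suc m) - 1#) * b       ≈⟨ [y-z]x≈yx-zx b (pow q (suc m)) 1# ⟩
        pow q (suc m) * b - 1# * b     ≈⟨ +-congˡ (-‿cong (*-identityˡ b)) ⟩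
        pow q (suc m) * b - b ∎

  weight : ℕ → Carrier
  weight t = pow q t * qint t * s

  hRec : ℕ → Poly
  hRec zero = 1# ∷ []
  hRec (suc zero) = Xop (hRec zero)
  hRec (suc (suc t)) = addP (Xop (hRec (suc t))) (scaleP (weight (suc t)) (hRec t))

  hCoeff : ℕ → ℕ → Carrier
  hCoeff t m = coeff (hRec t) m

  hCoeff-rec : ∀ t m → hCoeff (suc (suc t)) m ≈ Xs (hCoeff (suc t)) m + weight (suc t) * hCoeff t m
  hCoeff-rec t m = trans (coeff-addP (Xop (hRec (suc t))) (scaleP (weight (suc t)) (hRec t)) m)
    (+-cong (coeff-Xop {hRec (suc t)} (λ _ → refl) m) (coeff-scaleP _ (hRec t) m))

  hCoeff-above : ∀ t m → t < m → hCoeff t m ≈ 0#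
  hCoeff-above zero (suc m) lt = refl
  hCoeff-above (suc zero) (suc zero) (s≤s ())
  hCoeff-above (suc zero) (suc (suc m)) lt = refl
  hCoeff-above (suc (suc t)) (suc m) (s≤s lt) = begin
    hCoeff (suc (suc t)) (suc m)  ≈⟨ hCoeff-rec t (suc m) ⟩
    hCoeff (suc t) m + weight (suc t) * hCoeff t (suc m)
      ≈⟨ +-cong (hCoeff-above (suc t) m lt)
                (*-congˡ (hCoeff-above t (suc m) (ℕP.<-trans (ℕP.n<1+n t) (ℕP.<-trans lt (ℕP.n<1+n m))))) ⟩
    0# + weight (suc t) * 0#      ≈⟨ trans (+-identityˡ _) (zeroʳ _) ⟩
    0# ∎

  hCoeff-diag : ∀ m → hCoeff m m ≈ 1#
  hCoeff-diag zero = refl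
  hCoeff-diag (suc zero) = refl
  hCoeff-diag (suc (suc m)) = begin
    hCoeff (suc (suc m)) (suc (suc m))  ≈⟨ hCoeff-rec m (suc (suc m)) ⟩
    hCoeff (suc m) (suc m) + weight (suc m) * hCoeff m (suc (suc m))
      ≈⟨ +-cong (hCoeff-diag (suc m))
                (*-congˡ (hCoeff-above m (suc (suc m)) (ℕP.<-trans (ℕP.n<1+n m) (ℕP.n<1+n (suc m))))) ⟩
    1# + weight (suc m) * 0# ≈⟨ trans (+-congˡ (zeroʳ _)) (+-identityʳ _) ⟩
    1# ∎

  hCoeff-odd : ∀ m j → hCoeff (suc (double j +ℕ m)) m ≈ 0#
  hCoeff-odd zero zero = refl
  hCoeff-odd (suc m) zero = begin
    hCoeff (suc (suc m)) (suc m) ≈⟨ hCoeff-rec m (suc m) ⟩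
    hCoeff (suc m) m + weight (suc m) * hCoeff m (suc m)
      ≈⟨ +-cong (hCoeff-odd m zero) (*-congˡ (hCoeff-above m (suc m) (ℕP.n<1+n m))) ⟩
    0# + weight (suc m) * 0# ≈⟨ trans (+-identityˡ _) (zeroʳ _) ⟩
    0# ∎
  hCoeff-odd m (suc j) = begin
    hCoeff (suc (suc T)) m  ≈⟨ hCoeff-rec T m ⟩
    Xs (hCoeff (suc T)) m + weight (suc T) * hCoeff T m
      ≈⟨ +-cong (shifted m) (*-congˡ (hCoeff-odd m j)) ⟩
    0# + weight (suc T) * 0# ≈⟨ trans (+-identityˡ _) (zeroʳ _) ⟩
    0# ∎
    where
    T = suc (double j +ℕ m)
    shifted : ∀ m → Xs (hCoeff (suc (suc (double j +ℕ m)))) m ≈ 0#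
    shifted zero = refl
    shifted (suc m') = trans (reflexive (≡.cong (λ t → hCoeff t m') (≡.cong (suc ∘ suc) (ℕP.+-suc (double j) m'))))
                             (hCoeff-odd m' (suc j))

  denominator : ℕ → ℕ → Carrier
  denominator m j = onePlusProd j * qfact j * qfact m

  EvenCoeff : ℕ → ℕ → Set ℓ
  EvenCoeff m j = hCoeff (double j +ℕ m) m * denominator m j ≈ pow q (j *ℕ j) * pow s j * qfact (double j +ℕ m)

  evenCoeff-constant : ∀ j → EvenCoeff 0 j → EvenCoeff 0 (suc j)
  evenCoeff-constant j ih = begin
    hCoeff (suc (suc T)) 0 * (((A * P) * (Q * F)) * f0)
      ≈⟨ *-congʳ (trans (hCoeff-rec T 0) (+-identityˡ _)) ⟩
    (ps * qs * s * h) * (((A * P) * (Q * F)) * f0)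
      ≈⟨ solve 9 (λ ps qs s h A P Q F f0 → (ps :* qs :* s :* h) :* (((A :* P) :* (Q :* F)) :* f0)
                                         := (ps :* qs :* s) :* (A :* Q) :* (h :* (P :* F :* f0)))
                 refl ps qs s h A P Q F f0 ⟩
    (ps * qs * s) * (A * Q) * (h * (P * F * f0))
      ≈⟨ *-cong (*-congˡ (trans (onePlus-qint j) (reflexive (≡.cong (qint ∘ suc ∘ suc) (≡.sym (ℕP.+-identityʳ (double j))))))) ih ⟩
    (ps * qs * s) * Qd * (pjj * sj * fT)
      ≈⟨ solve 7 (λ ps qs s Qd pjj sj fT → (ps :* qs :* s) :* Qd :* (pjj :* sj :* fT)
                                         := (ps :* pjj) :* (s :* sj) :* (Qd :* (qs :* fT)))
                 refl ps qs s Qd pjj sj fT ⟩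
    (ps * pjj) * (s * sj) * (Qd * (qs * fT))
      ≈⟨ *-congʳ (*-congʳ (trans (sym (pow-+ q (suc T) (j *ℕ j))) (reflexive (≡.cong (pow q) (≡.sym (Exponents.square-step j)))))) ⟩
    pow q (suc j *ℕ suc j) * (s * sj) * (Qd * (qs * fT)) ∎
    where
    T = double j +ℕ 0
    h = hCoeff T 0
    A = 1# + pow q (suc j)
    P = onePlusProd j
    Q = qint (suc j)
    F = qfact j
    f0 = qfact 0
    ps = pow q (suc T)
    qs = qint (suc T)
    Qd = qint (suc (suc T))
    pjj = pow q (j *ℕ j)
    sj = pow s j
    fT = qfact T

  evenCoeff-step : ∀ m j → EvenCoeff m (suc j) → EvenCoeff (suc m) j → EvenCoeff (suc m) (suc j)
  evenCoeff-step m j ih₁ ih₂ = begin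
    hCoeff (suc (suc Tm)) (suc m) * (((A * P) * (Q * F)) * (qm1 * fm))
      ≈⟨ *-congʳ (hCoeff-rec Tm (suc m)) ⟩
    (x + weight (suc Tm) * b) * (((A * P) * (Q * F)) * (qm1 * fm))
      ≈⟨ solve 9 (λ x w b A P Q F qm1 fm → (x :+ w :* b) :* (((A :* P) :* (Q :* F)) :* (qm1 :* fm))
                   := (x :* ((A :* P) :* (Q :* F) :* fm)) :* qm1 :+ (w :* (A :* Q)) :* (b :* ((P :* F) :* (qm1 :* fm))))
                 refl x (weight (suc Tm)) b A P Q F qm1 fm ⟩
    (x * ((A * P) * (Q * F) * fm)) * qm1 + (weight (suc Tm) * (A * Q)) * (b * ((P * F) * (qm1 * fm)))
      ≈⟨ +-cong (*-congʳ (trans (*-congʳ (reflexive (≡.cong (λ t → hCoeff t m) Tm+1≡)))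
                               (trans ih₁ (*-congˡ (reflexive (≡.cong qfact (≡.sym Tm+1≡)))))))
                (*-cong (*-congˡ (onePlus-qint j)) ih₂) ⟩
    (Pj2 * (s * sj) * (qs * fT)) * qm1 + ((ps * qs * s) * Qd) * (pjj * sj * fT)
      ≈⟨ solve 9 (λ Pj2 s sj qs fT qm1 ps Qd pjj
                   → (Pj2 :* (s :* sj) :* (qs :* fT)) :* qm1 :+ ((ps :* qs :* s) :* Qd) :* (pjj :* sj :* fT)
                   := Pj2 :* (s :* sj) :* (qm1 :* (qs :* fT)) :+ (ps :* pjj) :* (Qd :* (s :* sj :* (qs :* fT))))
                 refl Pj2 s sj qs fT qm1 ps Qd pjj ⟩
    Pj2 * (s * sj) * (qm1 * (qs * fT)) + (ps * pjj) * (Qd * (s * sj * (qs * fT)))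
      ≈⟨ +-congˡ (*-congʳ (trans (sym (pow-+ q (suc Tm) (j *ℕ j)))
                                 (trans (reflexive (≡.cong (pow q) (Exponents.square-shift j m)))
                                        (pow-+ q (suc j *ℕ suc j) (suc m))))) ⟩
    Pj2 * (s * sj) * (qm1 * (qs * fT)) + (Pj2 * pm1) * (Qd * (s * sj * (qs * fT)))
      ≈⟨ solve 8 (λ Pj2 s sj qm1 qs fT pm1 Qd
                   → Pj2 :* (s :* sj) :* (qm1 :* (qs :* fT)) :+ (Pj2 :* pm1) :* (Qd :* (s :* sj :* (qs :* fT)))
                   := Pj2 :* (s :* sj) :* ((qm1 :+ pm1 :* Qd) :* (qs :* fT)))
                 refl Pj2 s sj qm1 qs fT pm1 Qd ⟩
    Pj2 * (s * sj) * ((qm1 + pm1 * Qd) * (qs * fT))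
      ≈⟨ *-congˡ (*-congʳ (trans (sym (qint-+ (suc m) (double (suc j))))
                                 (reflexive (≡.cong qint (Exponents.degree-shift j m))))) ⟩
    Pj2 * (s * sj) * (qint (suc (suc Tm)) * (qs * fT)) ∎
    where
    Tm = double j +ℕ suc m
    Tm+1≡ : suc Tm ≡ double (suc j) +ℕ m
    Tm+1≡ = ≡.cong suc (ℕP.+-suc (double j) m)
    x = hCoeff (suc Tm) m
    b = hCoeff Tm (suc m)
    A = 1# + pow q (suc j)
    P = onePlusProd j
    Q = qint (suc j)
    F = qfact j
    qm1 = qint (suc m)
    fm = qfact m
    Pj2 = pow q (suc j *ℕ suc j)
    sj = pow s j
    qs = qint (suc Tm)
    fT = qfact Tm
    ps = pow q (suc Tm)
    Qd = qint (double (suc j))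
    pjj = pow q (j *ℕ j)
    pm1 = pow q (suc m)

  evenCoeff : ∀ m j → EvenCoeff m j
  evenCoeff m zero = trans (*-congʳ (hCoeff-diag m)) (*-identityˡ _)
  evenCoeff zero (suc j) = evenCoeff-constant j (evenCoeff zero j)
  evenCoeff (suc m) (suc j) = evenCoeff-step m j (evenCoeff m (suc j)) (evenCoeff (suc m) j)

  module ClosedForm (nz-qint : ∀ m → NonZeroDivisor (qint (suc m)))
                    (nz-onePlus : ∀ m → NonZeroDivisor (1# + pow q (suc m)))
                    (C : ℕ → ℕ → Carrier) (isC : IsHCoeff C) where

    nz-denominator : ∀ m j → NonZeroDivisor (denominator m j)
    nz-denominator m j = nzd-* _ _ (nzd-* _ _ (nzd-product _ nz-onePlus onePlusProd refl (λ _ → refl) j)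
                                              (nz-qfact nz-qint j))
                                   (nz-qfact nz-qint m)

    term : ℕ → ℕ → Carrier
    term t j = pow q (j *ℕ j) * pow s j * C t j

    summand : ℕ → ℕ → ℕ → Carrier
    summand t m j = coeff (monomial (term t j) (t ∸ 2 *ℕ j)) m

    summand-range : ∀ t j → j < suc ⌊ t /2⌋ → 2 *ℕ j ≤ t
    summand-range t j (s≤s le) = ≡.subst (_≤ t) (double≡2* j) (double≤ t j le)

    even-term : ∀ m j → hCoeff (double j +ℕ m) m ≈ term (double j +ℕ m) j
    even-term m j = cancelʳ (denominator m j) (nz-denominator m j) _ _ (begin
      hCoeff t m * denominator m j       ≈⟨ evenCoeff m j ⟩
      pow q (j *ℕ j) * pow s j * qfact t ≈⟨ *-congˡ (sym (≡.subst (λ d → C t j * (onePlusProd j * qfact j * qfact d) ≈ qfact t)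
                                                                  (double+∸2* j m) (isC t j (summand-range t j (s≤s (≤half j m)))))) ⟩
      pow q (j *ℕ j) * pow s j * (C t j * denominator m j) ≈⟨ sym (*-assoc _ _ _) ⟩
      term t j * denominator m j ∎)
      where
      t = double j +ℕ m

    coeff-hPoly : ∀ t m → coeff (hPoly C t) m ≈ hCoeff t m
    coeff-hPoly t m = trans (coeff-sumP (λ j → monomial (term t j) (t ∸ 2 *ℕ j)) id (suc ⌊ t /2⌋) m) (by-position (position t m))
      where
      N = suc ⌊ t /2⌋
      degree : ∀ k → k < N → t ∸ 2 *ℕ k ≡ m → t ≡ double k +ℕ m
      degree k k<N = ∸double t k m (summand-range t k k<N)
      by-position : Position t m → Σ< N (summand t m) ≈ hCoeff t m
      by-position (above lt) = trans (Σ-0 N (summand t m) (λ k k<N → coeff-monomial-≢ _ _ m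
          (λ e → ℕP.<-irrefl ≡.refl (ℕP.≤-<-trans (≡.subst (_≤ t) e (ℕP.m∸n≤m t (2 *ℕ k))) lt))))
        (sym (hCoeff-above t m lt))
      by-position (odd j ≡.refl) = trans (Σ-0 N (summand t m) (λ k k<N → coeff-monomial-≢ _ _ m
          (λ e → double≢odd j k (ℕP.+-cancelʳ-≡ m _ _ (degree k k<N e)))))
        (sym (hCoeff-odd m j))
      by-position (even j ≡.refl) = begin
        Σ< N (summand t m) ≈⟨ Σ-single N (summand t m) j (s≤s (≤half j m)) (λ k k<N k≢j → coeff-monomial-≢ _ _ m
                                 (λ e → k≢j (double-injective k j (ℕP.+-cancelʳ-≡ m _ _ (≡.sym (degree k k<N e)))))) ⟩
        summand t m j       ≈⟨ reflexive (≡.cong (coeff (monomial (term t j) (t ∸ 2 *ℕ j))) (≡.sym (double+∸2* j m))) ⟩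
        coeff (monomial (term t j) (t ∸ 2 *ℕ j)) (t ∸ 2 *ℕ j) ≈⟨ coeff-monomial-≡ (term t j) (t ∸ 2 *ℕ j) ⟩
        term t j            ≈⟨ sym (even-term m j) ⟩
        hCoeff t m ∎

  -- The coefficients G n k = [n k] q^{kn}, by their q-Pascal recurrence
  --   G (n+1) (k+1) = q^{k+1} G n (k+1) + q^{2n+1} G n k.
  G : ℕ → ℕ → Carrier
  G zero zero = 1#
  G zero (suc k) = 0#
  G (suc n) zero = 1#
  G (suc n) (suc k) = pow q (suc k) * G n (suc k) + pow q (2 *ℕ n +ℕ 1) * G n k

  G-above : ∀ n k → n < k → G n k ≈ 0#
  G-above zero (suc k) lt = refl
  G-above (suc n) (suc k) (s≤s lt) = begin
    pow q (suc k) * G n (suc k) + pow q (2 *ℕ n +ℕ 1) * G n k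
      ≈⟨ +-cong (*-congˡ (G-above n (suc k) (ℕP.<-trans lt (ℕP.n<1+n k)))) (*-congˡ (G-above n k lt)) ⟩
    pow q (suc k) * 0# + pow q (2 *ℕ n +ℕ 1) * 0# ≈⟨ trans (+-cong (zeroʳ _) (zeroʳ _)) (+-identityˡ 0#) ⟩
    0# ∎

  G-zero : ∀ n → G n 0 ≈ 1#
  G-zero zero = refl
  G-zero (suc n) = refl

  Factorial : ℕ → ℕ → Set ℓ
  Factorial n k = G n k * (qfact k * qfact (n ∸ k)) ≈ pow q (k *ℕ n) * qfact n

  factorial-diag : ∀ n → Factorial n n → Factorial (suc n) (suc n)
  factorial-diag n ih = begin
    (pk1 * G n (suc n) + p2 * G n n) * (qfact (suc n) * qfact (n ∸ n))
      ≈⟨ *-congʳ (trans (+-congʳ (trans (*-congˡ (G-above n (suc n) (ℕP.n<1+n n))) (zeroʳ _))) (+-identityˡ _)) ⟩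
    (p2 * G n n) * ((Qn * qfact n) * qfact (n ∸ n))
      ≈⟨ solve 5 (λ p2 G Qn fn fz → (p2 :* G) :* ((Qn :* fn) :* fz) := (p2 :* (G :* (fn :* fz))) :* Qn)
                 refl p2 (G n n) Qn (qfact n) (qfact (n ∸ n)) ⟩
    (p2 * (G n n * (qfact n * qfact (n ∸ n)))) * Qn
      ≈⟨ *-congʳ (*-congˡ ih) ⟩
    (p2 * (pow q (n *ℕ n) * qfact n)) * Qn
      ≈⟨ solve 4 (λ p2 pnn fn Qn → (p2 :* (pnn :* fn)) :* Qn := (p2 :* pnn) :* (Qn :* fn)) refl p2 (pow q (n *ℕ n)) (qfact n) Qn ⟩
    (p2 * pow q (n *ℕ n)) * (Qn * qfact n)
      ≈⟨ *-congʳ (trans (sym (pow-+ q (2 *ℕ n +ℕ 1) (n *ℕ n))) (reflexive (≡.cong (pow q) (Exponents.pascal-top n)))) ⟩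
    pow q (suc n *ℕ suc n) * (Qn * qfact n) ∎
    where
    pk1 = pow q (suc n)
    p2 = pow q (2 *ℕ n +ℕ 1)
    Qn = qint (suc n)

  factorial-interior : ∀ t k → Factorial (t +ℕ suc k) (suc k) → Factorial (t +ℕ suc k) k →
                       Factorial (suc (t +ℕ suc k)) (suc k)
  factorial-interior t k ih₁ ih₀ = begin
    (pk1 * G1 + p2 * G0) * (qfact (suc k) * qfact (n ∸ k))
      ≈⟨ distribʳ _ _ _ ⟩
    (pk1 * G1) * (qfact (suc k) * qfact (n ∸ k)) + (p2 * G0) * ((Qk * qfact k) * qfact (n ∸ k))
      ≈⟨ +-congʳ (*-congˡ (*-congˡ (reflexive (≡.cong qfact (n∸k t k))))) ⟩
    (pk1 * G1) * (qfact (suc k) * (Qt * qfact t)) + (p2 * G0) * ((Qk * qfact k) * qfact (n ∸ k))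
      ≈⟨ +-cong (solve 5 (λ pk1 G1 fk Qt ft → (pk1 :* G1) :* (fk :* (Qt :* ft)) := (pk1 :* Qt) :* (G1 :* (fk :* ft)))
                         refl pk1 G1 (qfact (suc k)) Qt (qfact t))
                (solve 5 (λ p2 G0 Qk fk fnk → (p2 :* G0) :* ((Qk :* fk) :* fnk) := (p2 :* Qk) :* (G0 :* (fk :* fnk)))
                         refl p2 G0 Qk (qfact k) (qfact (n ∸ k))) ⟩
    (pk1 * Qt) * (G1 * (qfact (suc k) * qfact t)) + (p2 * Qk) * (G0 * (qfact k * qfact (n ∸ k)))
      ≈⟨ +-cong (*-congˡ (trans (*-congˡ (*-congˡ (reflexive (≡.cong qfact (≡.sym (n∸[k+1] t k)))))) ih₁)) (*-congˡ ih₀) ⟩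
    (pk1 * Qt) * (pow q (suc k *ℕ n) * fn) + (p2 * Qk) * (pow q (k *ℕ n) * fn)
      ≈⟨ solve 7 (λ pk1 Qt pk fn p2 Qk pkn → (pk1 :* Qt) :* (pk :* fn) :+ (p2 :* Qk) :* (pkn :* fn)
                                           := (pk1 :* pk) :* (Qt :* fn) :+ (p2 :* pkn) :* (Qk :* fn))
                 refl pk1 Qt (pow q (suc k *ℕ n)) fn p2 Qk (pow q (k *ℕ n)) ⟩
    (pk1 * pow q (suc k *ℕ n)) * (Qt * fn) + (p2 * pow q (k *ℕ n)) * (Qk * fn)
      ≈⟨ +-cong (*-congʳ (trans (sym (pow-+ q (suc k) (suc k *ℕ n))) (reflexive (≡.cong (pow q) (pascal-left k n)))))
                (*-congʳ (trans (sym (pow-+ q (2 *ℕ n +ℕ 1) (k *ℕ n)))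
                         (trans (reflexive (≡.cong (pow q) (pascal-right t k))) (pow-+ q (suc k *ℕ suc n) (suc t))))) ⟩
    P1 * (Qt * fn) + (P1 * pow q (suc t)) * (Qk * fn)
      ≈⟨ solve 5 (λ P1 Qt fn pt Qk → P1 :* (Qt :* fn) :+ (P1 :* pt) :* (Qk :* fn) := P1 :* ((Qt :+ pt :* Qk) :* fn))
                 refl P1 Qt fn (pow q (suc t)) Qk ⟩
    P1 * ((Qt + pow q (suc t) * Qk) * fn)
      ≈⟨ *-congˡ (*-congʳ (sym (qint-+ (suc t) (suc k)))) ⟩
    P1 * (qint (suc n) * fn) ∎
    where
    open Exponents
    n = t +ℕ suc k
    pk1 = pow q (suc k)
    p2 = pow q (2 *ℕ n +ℕ 1)
    G1 = G n (suc k)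
    G0 = G n k
    Qk = qint (suc k)
    Qt = qint (suc t)
    fn = qfact n
    P1 = pow q (suc k *ℕ suc n)

  factorial : ∀ n k → k ≤ n → Factorial n k
  factorial zero zero _ = *-identityˡ _
  factorial (suc n) zero _ = *-congˡ (*-identityˡ _)
  factorial (suc n) (suc k) (s≤s k≤n) with ℕP.m≤n⇒m<n∨m≡n k≤n
  ... | inj₂ ≡.refl = factorial-diag n (factorial n n ℕP.≤-refl)
  ... | inj₁ k<n with split< k<n
  ... | t , ≡.refl = factorial-interior t k (factorial n (suc k) k<n) (factorial n k (ℕP.<⇒≤ k<n))

  module Binomials (nz-qint : ∀ m → NonZeroDivisor (qint (suc m))) where

    -- Absorption: qⁿ [n-k] G n k = [k+1] G n (k+1), checked after multiplying by [k]! [n-k-1]!.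
    absorption : ∀ n k → k ≤ n → pow q n * qint (n ∸ k) * G n k ≈ qint (suc k) * G n (suc k)
    absorption n k k≤n with ℕP.m≤n⇒m<n∨m≡n k≤n
    ... | inj₂ ≡.refl = begin
      pow q k * qint (k ∸ k) * G k k ≈⟨ *-congʳ (*-congˡ (reflexive (≡.cong qint (ℕP.n∸n≡0 k)))) ⟩
      pow q k * 0# * G k k           ≈⟨ absorbˡ _ (zeroʳ _) ⟩
      0#                             ≈⟨ sym (trans (*-congˡ (G-above k (suc k) (ℕP.n<1+n k))) (zeroʳ _)) ⟩
      qint (suc k) * G k (suc k) ∎
    ... | inj₁ k<n with split< k<n
    ... | t , ≡.refl = cancelʳ (qfact k * qfact t) (nzd-* _ _ (nz-qfact nz-qint k) (nz-qfact nz-qint t)) _ _ (begin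
      (pn * qint (n ∸ k) * G0) * (qfact k * qfact t)
        ≈⟨ solve 5 (λ pn Q G0 fk ft → (pn :* Q :* G0) :* (fk :* ft) := pn :* (G0 :* (fk :* (Q :* ft))))
                   refl pn (qint (n ∸ k)) G0 (qfact k) (qfact t) ⟩
      pn * (G0 * (qfact k * (qint (n ∸ k) * qfact t)))
        ≈⟨ *-congˡ (*-congˡ (*-congˡ (trans (*-congʳ (reflexive (≡.cong qint (n∸k t k))))
                                            (reflexive (≡.cong qfact (≡.sym (n∸k t k))))))) ⟩
      pn * (G0 * (qfact k * qfact (n ∸ k)))     ≈⟨ *-congˡ (factorial n k (ℕP.<⇒≤ k<n)) ⟩
      pn * (pow q (k *ℕ n) * qfact n)           ≈⟨ sym (*-assoc _ _ _) ⟩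
      (pn * pow q (k *ℕ n)) * qfact n           ≈⟨ *-congʳ (sym (pow-+ q n (k *ℕ n))) ⟩
      pow q (suc k *ℕ n) * qfact n              ≈⟨ sym (factorial n (suc k) k<n) ⟩
      G1 * (qfact (suc k) * qfact (n ∸ suc k))  ≈⟨ *-congˡ (*-congˡ (reflexive (≡.cong qfact (n∸[k+1] t k)))) ⟩
      G1 * ((qint (suc k) * qfact k) * qfact t)
        ≈⟨ solve 4 (λ G1 Q fk ft → G1 :* ((Q :* fk) :* ft) := (Q :* G1) :* (fk :* ft)) refl G1 (qint (suc k)) (qfact k) (qfact t) ⟩
      (qint (suc k) * G1) * (qfact k * qfact t) ∎)
      where
      open Exponents
      pn = pow q n
      G0 = G n k
      G1 = G n (suc k)

    binomial : (B : ℕ → ℕ → Carrier) → IsQBinomial B → ∀ n k → k ≤ n → B n k * pow q (k *ℕ n) ≈ G n k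
    binomial B isB n k k≤n = cancelʳ (qfact k * qfact (n ∸ k)) (nzd-* _ _ (nz-qfact nz-qint k) (nz-qfact nz-qint (n ∸ k))) _ _ (begin
      (B n k * pow q (k *ℕ n)) * (qfact k * qfact (n ∸ k))
        ≈⟨ solve 3 (λ b p f → (b :* p) :* f := p :* (b :* f)) refl (B n k) (pow q (k *ℕ n)) (qfact k * qfact (n ∸ k)) ⟩
      pow q (k *ℕ n) * (B n k * (qfact k * qfact (n ∸ k))) ≈⟨ *-congˡ (isB n k k≤n) ⟩
      pow q (k *ℕ n) * qfact n                             ≈⟨ sym (factorial n k k≤n) ⟩
      G n k * (qfact k * qfact (n ∸ k)) ∎)

  hMul : ℕ → Seq → Seq
  hMul t = polyMul (hRec t)

  hMul-index : ∀ {t t'} a m → t ≡ t' → hMul t a m ≈ hMul t' a m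
  hMul-index a m e = reflexive (≡.cong (λ t → hMul t a m) e)

  hMul-0 : ∀ a → hMul 0 a ≈S a
  hMul-0 a m = trans (+-cong (*-identityˡ _) (Xs-0 _ (λ _ → refl) m)) (+-identityʳ _)

  -- h_{t+1} = X h_t + w_t h_{t-1}, valid also for t = 0 since w₀ = 0
  hMul-rec : ∀ t a m → hMul (suc t) a m ≈ Xs (hMul t a) m + weight t * hMul (t ∸ 1) a m
  hMul-rec zero a m = trans (polyMul-Xop (hRec 0) a m)
    (sym (trans (+-congˡ (absorbˡ _ (absorbˡ s (zeroʳ _)))) (+-identityʳ _)))
  hMul-rec (suc t) a m = trans (polyMul-addP (Xop (hRec (suc t))) (scaleP (weight (suc t)) (hRec t)) a m)
    (+-cong (polyMul-Xop (hRec (suc t)) a m) (polyMul-scaleP (weight (suc t)) (hRec t) a m))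

  sD : Seq → Seq
  sD a m = s * Ds a m

  sD-cong : ∀ {a b} → a ≈S b → sD a ≈S sD b
  sD-cong e m = *-congˡ (Ds-cong e m)

  sD-+ : ∀ a b → sD (a +S b) ≈S (sD a +S sD b)
  sD-+ a b m = trans (*-congˡ (distribˡ _ _ _)) (distribˡ _ _ _)

  sD-· : ∀ r a → sD (r ·S a) ≈S (r ·S sD a)
  sD-· r a m = solve 4 (λ s Q r a → s :* (Q :* (r :* a)) := r :* (s :* (Q :* a))) refl s (qint (suc m)) r (a (suc m))

  sD-0 : ∀ a → a ≈S 0S → sD a ≈S 0S
  sD-0 a e m = trans (*-congˡ (trans (*-congˡ (e (suc m))) (zeroʳ _))) (zeroʳ s)

  sD-Xs : ∀ a m → sD (Xs a) m ≈ q * Xs (sD a) m + s * a m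
  sD-Xs a zero = begin
    s * (qint 1 * a 0) ≈⟨ *-congˡ (trans (*-congʳ qint-1) (*-identityˡ _)) ⟩
    s * a 0            ≈⟨ sym (trans (+-congʳ (zeroʳ q)) (+-identityˡ _)) ⟩
    q * 0# + s * a 0 ∎
  sD-Xs a (suc m) = begin
    s * ((1# + q * qint (suc m)) * a (suc m))
      ≈⟨ solve 5 (λ s o q Q a → s :* ((o :+ q :* Q) :* a) := q :* (s :* (Q :* a)) :+ s :* (o :* a))
                 refl s 1# q (qint (suc m)) (a (suc m)) ⟩
    q * (s * (qint (suc m) * a (suc m))) + s * (1# * a (suc m))
      ≈⟨ +-congˡ (*-congˡ (*-identityˡ _)) ⟩
    q * (s * (qint (suc m) * a (suc m))) + s * a (suc m) ∎

  sD^ : ℕ → Seq → Seq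
  sD^ zero = id
  sD^ (suc k) = sD ∘ sD^ k

  sD^-shift : ∀ k a → sD^ k (sD a) ≡ sD^ (suc k) a
  sD^-shift zero a = ≡.refl
  sD^-shift (suc k) a = ≡.cong sD (sD^-shift k a)

  sD^-cong : ∀ k {a b} → a ≈S b → sD^ k a ≈S sD^ k b
  sD^-cong zero e = e
  sD^-cong (suc k) {a} {b} e = sD-cong {sD^ k a} {sD^ k b} (sD^-cong k e)

  sD^-+ : ∀ k a b → sD^ k (a +S b) ≈S (sD^ k a +S sD^ k b)
  sD^-+ zero a b m = refl
  sD^-+ (suc k) a b m =
    trans (sD-cong {sD^ k (a +S b)} {sD^ k a +S sD^ k b} (sD^-+ k a b) m) (sD-+ (sD^ k a) (sD^ k b) m)

  sD^-· : ∀ k r a → sD^ k (r ·S a) ≈S (r ·S sD^ k a)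
  sD^-· zero r a m = refl
  sD^-· (suc k) r a m =
    trans (sD-cong {sD^ k (r ·S a)} {r ·S sD^ k a} (sD^-· k r a) m) (sD-· r (sD^ k a) m)

  -- The commutation rule (sD)ᵏ X = qᵏ X (sD)ᵏ + [k] s (sD)^{k-1}; its second term:
  lower : ℕ → Seq → Seq
  lower zero a = 0S
  lower (suc k) a = (qint (suc k) * s) ·S sD^ k a

  sD-lower : ∀ k a m → sD (lower k a) m ≈ qint k * s * sD^ k a m
  sD-lower zero a m = trans (sD-0 _ (λ _ → refl) m) (sym (absorbˡ _ (absorbˡ s refl)))
  sD-lower (suc k) a m = sD-· _ (sD^ k a) m

  commutation : ∀ k a m → sD^ k (Xs a) m ≈ pow q k * Xs (sD^ k a) m + lower k a m
  commutation zero a m = sym (trans (+-identityʳ _) (*-identityˡ _))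
  commutation (suc k) a m = begin
    sD (sD^ k (Xs a)) m
      ≈⟨ sD-cong {sD^ k (Xs a)} {(pow q k ·S Xs (sD^ k a)) +S lower k a} (commutation k a) m ⟩
    sD ((pow q k ·S Xs (sD^ k a)) +S lower k a) m
      ≈⟨ sD-+ (pow q k ·S Xs (sD^ k a)) (lower k a) m ⟩
    sD (pow q k ·S Xs (sD^ k a)) m + sD (lower k a) m
      ≈⟨ +-cong (trans (sD-· (pow q k) (Xs (sD^ k a)) m) (*-congˡ (sD-Xs (sD^ k a) m))) (sD-lower k a m) ⟩
    pow q k * (q * Xs (sD^ (suc k) a) m + s * sD^ k a m) + qint k * s * sD^ k a m
      ≈⟨ solve 6 (λ p q X s u Q → p :* (q :* X :+ s :* u) :+ Q :* s :* u := (q :* p) :* X :+ (p :+ Q) :* s :* u)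
                 refl (pow q k) q (Xs (sD^ (suc k) a) m) s (sD^ k a m) (qint k) ⟩
    pow q (suc k) * Xs (sD^ (suc k) a) m + (pow q k + qint k) * s * sD^ k a m
      ≈⟨ +-congˡ (*-congʳ (*-congʳ (sym (qint-suc k)))) ⟩
    pow q (suc k) * Xs (sD^ (suc k) a) m + lower (suc k) a m ∎

  factor : ℕ → Seq → Seq
  factor i a = Xs a +S ((pow q (2 *ℕ i +ℕ 1) * s) ·S Ds a)

  factor-cong : ∀ i {a b} → a ≈S b → factor i a ≈S factor i b
  factor-cong i e m = +-cong (Xs-cong e m) (*-congˡ (Ds-cong e m))

  sD^-factor : ∀ n k a m → sD^ k (factor n a) m
               ≈ (pow q k * Xs (sD^ k a) m + lower k a m) + pow q (2 *ℕ n +ℕ 1) * sD^ (suc k) a m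
  sD^-factor n k a m = begin
    sD^ k (factor n a) m ≈⟨ sD^-+ k _ _ m ⟩
    sD^ k (Xs a) m + sD^ k ((pow q (2 *ℕ n +ℕ 1) * s) ·S Ds a) m
      ≈⟨ +-cong (commutation k a m) (trans (sD^-cong k (λ m' → *-assoc _ s _) m) (sD^-· k _ (sD a) m)) ⟩
    (pow q k * Xs (sD^ k a) m + lower k a m) + pow q (2 *ℕ n +ℕ 1) * sD^ k (sD a) m
      ≈⟨ +-congˡ (*-congˡ (reflexive (≡.cong (λ b → b m) (sD^-shift k a)))) ⟩
    (pow q k * Xs (sD^ k a) m + lower k a m) + pow q (2 *ℕ n +ℕ 1) * sD^ (suc k) a m ∎

  factors : (ℕ → ℕ) → ℕ → Seq → Seq
  factors g zero a = a
  factors g (suc n) a = factor (g 0) (factors (g ∘ suc) n a)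

  factors-inner : ∀ g n a → factors g (suc n) a ≈S factors g n (factor (g n) a)
  factors-inner g zero a m = refl
  factors-inner g (suc n) a = factor-cong (g 0) {factors (g ∘ suc) (suc n) a}
    {factors (g ∘ suc) n (factor (g (suc n)) a)} (factors-inner (g ∘ suc) n a)

  rhsTerm : ℕ → Seq → ℕ → ℕ → Carrier
  rhsTerm n a m k = G n k * hMul (n ∸ k) (sD^ k a) m

  rhsSum : ℕ → ℕ → Seq → ℕ → Carrier
  rhsSum n N a m = Σ< N (rhsTerm n a m)

  beyondˡ : ∀ {n k} x → n < k → G n k * x ≈ 0#
  beyondˡ {n} {k} x lt = absorbˡ x (G-above n k lt)

  beyondʳ : ∀ {n k} x → n < k → x * G n k ≈ 0#
  beyondʳ {n} {k} x lt = trans (*-congˡ (G-above n k lt)) (zeroʳ x)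

  shiftPart lowerPart raisePart : ℕ → Seq → ℕ → ℕ → Carrier
  shiftPart n a m k = G n k * (pow q k * Xs (hMul (n ∸ k) (sD^ k a)) m)
  lowerPart n a m k = G n k * hMul (n ∸ k) (lower k a) m
  raisePart n a m k = G n k * (pow q (2 *ℕ n +ℕ 1) * hMul (n ∸ k) (sD^ (suc k) a) m)

  rhsTerm-factor : ∀ n a m k → rhsTerm n (factor n a) m k
                   ≈ (shiftPart n a m k + lowerPart n a m k) + raisePart n a m k
  rhsTerm-factor n a m k = begin
    G n k * hMul t (sD^ k (factor n a)) m
      ≈⟨ *-congˡ (polyMul-cong (hRec t) {sD^ k (factor n a)} {((pk ·S Xs (sD^ k a)) +S lower k a) +S (p2 ·S sD^ (suc k) a)}
                               (sD^-factor n k a) m) ⟩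
    G n k * hMul t (((pk ·S Xs (sD^ k a)) +S lower k a) +S (p2 ·S sD^ (suc k) a)) m
      ≈⟨ *-congˡ (trans (polyMul-+ (hRec t) _ _ m) (+-cong (polyMul-+ (hRec t) _ _ m) (polyMul-· (hRec t) p2 (sD^ (suc k) a) m))) ⟩
    G n k * ((hMul t (pk ·S Xs (sD^ k a)) m + hMul t (lower k a) m) + p2 * hMul t (sD^ (suc k) a) m)
      ≈⟨ *-congˡ (+-congʳ (+-congʳ (trans (polyMul-· (hRec t) pk (Xs (sD^ k a)) m) (*-congˡ (polyMul-Xs (hRec t) (sD^ k a) m))))) ⟩
    G n k * ((pk * Xs (hMul t (sD^ k a)) m + hMul t (lower k a) m) + p2 * hMul t (sD^ (suc k) a) m)
      ≈⟨ solve 4 (λ g x y z → g :* ((x :+ y) :+ z) := (g :* x :+ g :* y) :+ g :* z) refl (G n k) _ _ _ ⟩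
    (shiftPart n a m k + lowerPart n a m k) + raisePart n a m k ∎
    where
    t = n ∸ k
    pk = pow q k
    p2 = pow q (2 *ℕ n +ℕ 1)

  -- The key identity: each term of the right-hand side for n+1 is recombined from
  -- the parts above, by the recurrences for h and G and by absorption.
  StepIdentity : ℕ → Seq → ℕ → ℕ → Set ℓ
  StepIdentity n a m k =
    rhsTerm (suc n) a m k ≈ (shiftPart n a m k + lowerPart n a m (suc k)) + shiftUp (raisePart n a m) k

  step-beyond : ∀ n k a m → n < k → StepIdentity n a m (suc k)
  step-beyond n k a m n<k = trans (beyondˡ _ (s≤s n<k)) (sym (begin
    (shiftPart n a m (suc k) + lowerPart n a m (suc (suc k))) + raisePart n a m k
      ≈⟨ +-cong (+-cong (beyondˡ _ n<k+1) (beyondˡ _ (ℕP.<-trans n<k+1 (ℕP.n<1+n (suc k))))) (beyondˡ _ n<k) ⟩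
    (0# + 0#) + 0#  ≈⟨ trans (+-identityʳ _) (+-identityʳ _) ⟩
    0# ∎))
    where
    n<k+1 : n < suc k
    n<k+1 = ℕP.<-trans n<k (ℕP.n<1+n k)

  step-top : ∀ n a m → StepIdentity n a m (suc n)
  step-top n a m = begin
    (pow q (suc n) * G n (suc n) + p2 * G n n) * H
      ≈⟨ *-congʳ (trans (+-congʳ (beyondʳ _ (ℕP.n<1+n n))) (+-identityˡ _)) ⟩
    (p2 * G n n) * H
      ≈⟨ solve 3 (λ p g h → (p :* g) :* h := g :* (p :* h)) refl p2 (G n n) H ⟩
    G n n * (p2 * H)
      ≈⟨ sym (trans (+-congʳ (trans (+-cong (beyondˡ _ (ℕP.n<1+n n)) (beyondˡ _ (ℕP.<-trans (ℕP.n<1+n n) (ℕP.n<1+n (suc n)))))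
                                    (+-identityˡ 0#)))
                    (+-identityˡ _)) ⟩
    (shiftPart n a m (suc n) + lowerPart n a m (suc (suc n))) + raisePart n a m n ∎
    where
    p2 = pow q (2 *ℕ n +ℕ 1)
    H = hMul (n ∸ n) (sD^ (suc n) a) m

  module Induction (nz-qint : ∀ m → NonZeroDivisor (qint (suc m))) where
    open Binomials nz-qint

    -- At the bottom k = 0 this is the recurrence h_{n+1} = X h_n + w_n h_{n-1}.
    step-bottom : ∀ n a m → StepIdentity n a m 0
    step-bottom n a m = sym (begin
      (G n 0 * (1# * X) + G n 1 * hMul (n ∸ 1) ((qint 1 * s) ·S a) m) + 0#
        ≈⟨ trans (+-identityʳ _) (+-congˡ (*-congˡ (polyMul-· (hRec (n ∸ 1)) (qint 1 * s) a m))) ⟩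
      G n 0 * (1# * X) + G n 1 * ((qint 1 * s) * H)
        ≈⟨ +-cong (*-congʳ (G-zero n)) (solve 4 (λ g q1 s h → g :* ((q1 :* s) :* h) := (q1 :* g) :* (s :* h)) refl (G n 1) (qint 1) s H) ⟩
      1# * (1# * X) + (qint 1 * G n 1) * (s * H)
        ≈⟨ +-cong (trans (*-identityˡ _) (*-identityˡ _)) (*-congʳ absorb₀) ⟩
      X + (pow q n * qint n) * (s * H)  ≈⟨ +-congˡ (sym (*-assoc _ s H)) ⟩
      X + weight n * H                  ≈⟨ sym (hMul-rec n a m) ⟩
      hMul (suc n) a m                  ≈⟨ sym (*-identityˡ _) ⟩
      1# * hMul (suc n) a m ∎)
      where
      X = Xs (hMul n a) m
      H = hMul (n ∸ 1) a m
      absorb₀ : qint 1 * G n 1 ≈ pow q n * qint n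
      absorb₀ = trans (sym (absorption n 0 z≤n)) (trans (*-congˡ (G-zero n)) (*-identityʳ _))

    -- In the interior, expand G (n+1) (k+1) by q-Pascal and h_{n-k} by its
    -- recurrence; the cross term is matched with lowerPart by absorption.
    step-interior : ∀ t k a m → StepIdentity (t +ℕ suc k) a m (suc k)
    step-interior t k a m = begin
      (pk1 * G1 + p2 * G0) * hMul (n ∸ k) Y m
        ≈⟨ *-congˡ (trans (hMul-index Y m (n∸k t k)) (hMul-rec t Y m)) ⟩
      (pk1 * G1 + p2 * G0) * (XH + (pt * qt * s) * H)
        ≈⟨ solve 9 (λ pk1 G1 p2 G0 XH pt qt s H → (pk1 :* G1 :+ p2 :* G0) :* (XH :+ (pt :* qt :* s) :* H)
                     := (G1 :* (pk1 :* XH) :+ ((pk1 :* pt) :* qt :* G1) :* (s :* H)) :+ G0 :* (p2 :* (XH :+ (pt :* qt :* s) :* H)))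
                   refl pk1 G1 p2 G0 XH pt qt s H ⟩
      (G1 * (pk1 * XH) + ((pk1 * pt) * qt * G1) * (s * H)) + G0 * (p2 * (XH + (pt * qt * s) * H))
        ≈⟨ +-congʳ (+-congˡ (*-congʳ absorb)) ⟩
      (G1 * (pk1 * XH) + (Q2 * G2) * (s * H)) + G0 * (p2 * (XH + (pt * qt * s) * H))
        ≈⟨ +-congʳ (+-congˡ (solve 4 (λ Q2 G2 s H → (Q2 :* G2) :* (s :* H) := G2 :* ((Q2 :* s) :* H)) refl Q2 G2 s H)) ⟩
      (G1 * (pk1 * XH) + G2 * ((Q2 * s) * H)) + G0 * (p2 * (XH + (pt * qt * s) * H))
        ≈⟨ sym (+-cong (+-cong (*-congˡ (*-congˡ (Xs-cong {hMul (n ∸ suc k) Y} {hMul t Y} (λ m' → hMul-index Y m' (n∸[k+1] t k)) m)))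
                               (*-congˡ (trans (polyMul-· (hRec (n ∸ suc (suc k))) (Q2 * s) Y m) (*-congˡ (hMul-index Y m (n∸[k+2] t k))))))
                       (*-congˡ (*-congˡ (trans (hMul-index Y m (n∸k t k)) (hMul-rec t Y m))))) ⟩
      (shiftPart n a m (suc k) + lowerPart n a m (suc (suc k))) + raisePart n a m k ∎
      where
      open Exponents
      n = t +ℕ suc k
      pk1 = pow q (suc k)
      p2 = pow q (2 *ℕ n +ℕ 1)
      G0 = G n k
      G1 = G n (suc k)
      G2 = G n (suc (suc k))
      Q2 = qint (suc (suc k))
      Y = sD^ (suc k) a
      XH = Xs (hMul t Y) m
      H = hMul (t ∸ 1) Y m
      pt = pow q t
      qt = qint t
      -- q^{k+1} qᵗ [t] G n (k+1) = [k+2] G n (k+2), as n - (k+1) = t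
      absorb : (pk1 * pt) * qt * G1 ≈ Q2 * G2
      absorb = trans (*-congʳ (*-congʳ (trans (sym (pow-+ q (suc k) t)) (reflexive (≡.cong (pow q) (ℕP.+-comm (suc k) t))))))
                     (trans (*-congʳ (*-congˡ (reflexive (≡.cong qint (≡.sym (n∸[k+1] t k))))))
                            (absorption n (suc k) (ℕP.<-≤-trans (ℕP.n<1+n k) (ℕP.m≤n+m (suc k) t))))

    step : ∀ n a m k → StepIdentity n a m k
    step n a m zero = step-bottom n a m
    step n a m (suc k) with ℕP.<-cmp k n
    ... | tri> _ _ n<k = step-beyond n k a m n<k
    ... | tri≈ _ ≡.refl _ = step-top k a m
    ... | tri< k<n _ _ with split< k<n
    ... | t , ≡.refl = step-interior t k a m

    sequence-identity : ∀ n a m → factors id n a m ≈ rhsSum n (suc n) a m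
    sequence-identity zero a m = sym (trans (+-identityʳ _) (trans (*-identityˡ _) (hMul-0 a m)))
    sequence-identity (suc n) a m = begin
      factors id (suc n) a m           ≈⟨ factors-inner id n a m ⟩
      factors id n (factor n a) m      ≈⟨ sequence-identity n (factor n a) m ⟩
      rhsSum n (suc n) (factor n a) m  ≈⟨ sym (Σ-drop-last (suc n) (rhsTerm n (factor n a) m) (beyondˡ _ n<n+1)) ⟩
      rhsSum n (suc (suc n)) (factor n a) m
        ≈⟨ Σ-cong (suc (suc n)) (λ k _ → rhsTerm-factor n a m k) ⟩
      Σ< (suc (suc n)) (λ k → (A k + B k) + C k)
        ≈⟨ Σ-regroup (suc (suc n)) A B C (beyondˡ _ n<n+2) lower-0 (beyondˡ _ n<n+2) (beyondˡ _ n<n+3) ⟩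
      Σ< (suc (suc (suc n))) (λ k → (A k + B (suc k)) + shiftUp C k)
        ≈⟨ sym (Σ-cong (suc (suc (suc n))) (λ k _ → step n a m k)) ⟩
      rhsSum (suc n) (suc (suc (suc n))) a m
        ≈⟨ Σ-drop-last (suc (suc n)) (rhsTerm (suc n) a m) (beyondˡ _ (ℕP.n<1+n (suc n))) ⟩
      rhsSum (suc n) (suc (suc n)) a m ∎
      where
      A = shiftPart n a m
      B = lowerPart n a m
      C = raisePart n a m
      lower-0 : B 0 ≈ 0#
      lower-0 = trans (*-congˡ (polyMul-0 (hRec n) (lower 0 a) (λ _ → refl) m)) (zeroʳ _)
      n<n+1 : n < suc n
      n<n+1 = ℕP.n<1+n n
      n<n+2 : n < suc (suc n)
      n<n+2 = ℕP.<-trans n<n+1 (ℕP.n<1+n (suc n))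
      n<n+3 : n < suc (suc (suc n))
      n<n+3 = ℕP.<-trans n<n+2 (ℕP.n<1+n (suc (suc n)))

  module Polynomials (nzq : NonZeroDivisor (q - 1#))
                     (nz-qint : ∀ m → NonZeroDivisor (qint (suc m)))
                     (nz-onePlus : ∀ m → NonZeroDivisor (1# + pow q (suc m)))
                     (D : Op) (isD : IsQDerivative D)
                     (B : ℕ → ℕ → Carrier) (isB : IsQBinomial B)
                     (C : ℕ → ℕ → Carrier) (isC : IsHCoeff C) where
    open QDerivative nzq D isD
    open ClosedForm nz-qint nz-onePlus C isC
    open Binomials nz-qint
    open Induction nz-qint

    factorOp : ℕ → Op
    factorOp i f = addP (Xop f) (scaleP (pow q (2 *ℕ i +ℕ 1) * s) (D f))

    coeff-factors : ∀ g n f → HasCoeffs (compOps (map factorOp (applyUpTo g n)) f) (factors g n (coeff f))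
    coeff-factors g zero f m = refl
    coeff-factors g (suc n) f m = trans (coeff-addP (Xop F) (scaleP (pow q (2 *ℕ g 0 +ℕ 1) * s) (D F)) m)
      (+-cong (coeff-Xop (coeff-factors (g ∘ suc) n f) m)
              (trans (coeff-scaleP _ (D F) m) (*-congˡ (coeff-D (coeff-factors (g ∘ suc) n f) m))))
      where
      F = compOps (map factorOp (applyUpTo (g ∘ suc) n)) f

    sDOp : Op
    sDOp g = scaleP s (D g)

    coeff-sD^ : ∀ k f → HasCoeffs (iterOp k sDOp f) (sD^ k (coeff f))
    coeff-sD^ zero f m = refl
    coeff-sD^ (suc k) f m = trans (coeff-scaleP s (D (iterOp k sDOp f)) m) (*-congˡ (coeff-D (coeff-sD^ k f) m))

    coeff-rhs : ∀ n f → HasCoeffs (rhsOp D B C n f) (rhsSum n (suc n) (coeff f))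
    coeff-rhs n f m = trans (coeff-sumP summandOp id (suc n) m) (Σ-cong (suc n) coeff-summand)
      where
      summandOp : ℕ → Poly
      summandOp k = scaleP (B n k * pow q (k *ℕ n)) (mulBy (hPoly C (n ∸ k)) (iterOp k sDOp f))
      coeff-summand : ∀ k → k < suc n → coeff (summandOp k) m ≈ rhsTerm n (coeff f) m k
      coeff-summand k (s≤s k≤n) = trans (coeff-scaleP _ (mulBy (hPoly C (n ∸ k)) (iterOp k sDOp f)) m)
        (*-cong (binomial B isB n k k≤n)
                (trans (coeff-mulP (hPoly C (n ∸ k)) (iterOp k sDOp f) (coeff-sD^ k f) m)
                       (polyMul-≈P (hPoly C (n ∸ k)) (hRec (n ∸ k)) _ (coeff-hPoly (n ∸ k)) m)))

    operator-identity : ∀ n → lhsOp D n ≈O rhsOp D B C n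
    operator-identity n f m =
      trans (coeff-factors id n f m) (trans (sequence-identity n (coeff f) m) (sym (coeff-rhs n f m)))

theorem3 : ∀ {c ℓ} (R : CommutativeRing c ℓ) (q s : CommutativeRing.Carrier R) →
    let open QOps R q s in
    NonZeroDivisor (q - 1#) →
    (∀ m → NonZeroDivisor (qint (suc m))) →
    (∀ m → NonZeroDivisor (1# + pow q (suc m))) →
    (D : Op) → IsQDerivative D →
    (B : ℕ → ℕ → Carrier) → IsQBinomial B →
    (C : ℕ → ℕ → Carrier) → IsHCoeff C →
    (n : ℕ) → lhsOp D n ≈O rhsOp D B C n
theorem3 R q s nzq nz-qint nz-onePlus D isD B isB C isC =
  Development.Polynomials.operator-identity R q s nzq nz-qint nz-onePlus D isD B isB C isC
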